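{- Let $G=(V,E)$ be a graph and let $A,B\subseteq V$ be independent offensive alliances of $G$ such that $B$ is obtained from $A$ by one token sliding step. Let $x$ be the unique vertex of $A\setminus B$ and $y$ the unique vertex of $B\setminus A$. Then $\{x,y\}\in E$ is an isolated edge of $G$, i.e. $N[x]=\{x,y\}=N[y]$.
   Context: Graphs are finite, simple, undirected. For $A\subseteq V$: $N(A)=\bigcup_{v\in A}N(v)$, $\partial A=N(A)\setminus A$, $d_A(v)=|N(v)\cap A|$. $A$ is an offensive alliance if $d_A(v)\ge d_{V\setminus A}(v)+1$ for all $v\in\partial A$; an independent offensive alliance is an offensive alliance that is an independent set. $B$ is obtained from $A$ by a token sliding step if $|A|=|B|$, $|A\setminus B|=1$, and the vertex in $A\setminus B$ is adjacent to the vertex in $B\setminus A$. An isolated edge is an edge both of whose endpoints have degree one. -}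

module Defs where

open import Data.Bool using (Bool; true; false; T)
open import Data.Nat using (ℕ; _≥_; suc)
open import Data.Fin using (Fin)
open import Data.Fin.Subset using (Subset; _∈_; _∉_; _∩_; _∪_; _─_; ∁; ∣_∣; ⁅_⁆)
open import Data.Vec using (tabulate)
open import Data.Product using (∃; _×_)
open import Relation.Binary.PropositionalEquality using (_≡_)

record Graph (n : ℕ) : Set where
  field
    adj    : Fin n → Fin n → Bool
    sym    : ∀ u v → adj u v ≡ adj v u
    irrefl : ∀ v → adj v v ≡ false
open Graph public

module _ {n : ℕ} (G : Graph n) where

  Adj : Fin n → Fin n → Set
  Adj u v = T (adj G u v)

  N : Fin n → Subset n
  N v = tabulate (λ u → adj G v u)

  N[_] : Fin n → Subset n
  N[ v ] = N v ∪ ⁅ v ⁆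

  deg : Subset n → Fin n → ℕ
  deg A v = ∣ N v ∩ A ∣

  InBoundary : Subset n → Fin n → Set
  InBoundary A v = v ∉ A × ∃ λ u → u ∈ A × Adj u v

  OffensiveAlliance : Subset n → Set
  OffensiveAlliance A = ∀ v → InBoundary A v → deg A v ≥ suc (deg (∁ A) v)

  Independent : Subset n → Set
  Independent A = ∀ u v → u ∈ A → v ∈ A → adj G u v ≡ false

  IndependentOffensiveAlliance : Subset n → Set
  IndependentOffensiveAlliance A = Independent A × OffensiveAlliance A

  TokenSlide : Subset n → Subset n → Fin n → Fin n → Set
  TokenSlide A B x y = ∣ A ∣ ≡ ∣ B ∣ × (A ─ B ≡ ⁅ x ⁆) × (B ─ A ≡ ⁅ y ⁆) × Adj x y

-- The
-- neighbours of y lie outside B (B is independent), so the only neighbour of y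
-- in A is x, the unique vertex of A ∖ B. Hence y is a boundary vertex of A with
-- d_A(y) ≤ 1, and the offensive inequality forces d_{V∖A}(y) = 0: N(y) = {x}.
-- Sliding back from B to A gives N(x) = {y} in the same way.
module Submission where

open import Defs hiding (sym)
open import Data.Bool using (T)
open import Data.Bool.Properties using (T-≡)
open import Data.Nat using (ℕ; _≤_; _<_; s≤s)
open import Data.Nat.Properties using (≤-trans; n≮n)
open import Data.Fin using (Fin)
open import Data.Fin.Subset using (Subset; _∈_; _∉_; _∩_; _∪_; _─_; ∁; ∣_∣; ⁅_⁆; _⊆_; inside; outside)
open import Data.Fin.Subset.Properties
  using (⊆-antisym; p⊆q⇒∣p∣≤∣q∣; ∣⁅x⁆∣≡1; x∈⁅x⁆; x∈⁅y⁆⇒x≡y; x∈p∩q⁺; x∈p∩q⁻;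
         x∉p⇒x∈∁p; p─q⊆p; x∈p∧x∉q⇒x∈p─q; ∪-comm; _∈?_)
open import Data.Vec using (_∷_; here; there)
open import Data.Vec.Properties using (lookup∘tabulate; []=⇒lookup; lookup⇒[]=)
open import Data.Product using (_×_; _,_)
open import Function using (_∘_; _⇔_; mk⇔; Equivalence)
open import Data.Empty using (⊥-elim)
open import Relation.Nullary using (yes; no)
open import Relation.Binary.PropositionalEquality using (_≡_; sym; trans; cong; subst)

private
  variable
    m : ℕ
    p q : Subset m
    x : Fin m

x∈p─q⇒x∉q : x ∈ p ─ q → x ∉ q
x∈p─q⇒x∉q {p = _ ∷ _} {q = inside  ∷ _} ()        here
x∈p─q⇒x∉q {p = _ ∷ _} {q = outside ∷ _} here      ()
x∈p─q⇒x∉q {p = _ ∷ _} {q = _       ∷ _} (there x∈p─q) (there x∈q) = x∈p─q⇒x∉q x∈p─q x∈q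

x∈p⇒0<∣p∣ : x ∈ p → 0 < ∣ p ∣
x∈p⇒0<∣p∣ {x = x} {p = p} x∈p =
  subst (_≤ ∣ p ∣) (∣⁅x⁆∣≡1 x) (p⊆q⇒∣p∣≤∣q∣ λ u∈⁅x⁆ → subst (_∈ p) (sym (x∈⁅y⁆⇒x≡y x u∈⁅x⁆)) x∈p)

p⊆⁅x⁆⇒∣p∣≤1 : p ⊆ ⁅ x ⁆ → ∣ p ∣ ≤ 1
p⊆⁅x⁆⇒∣p∣≤1 {x = x} p⊆⁅x⁆ = subst (_ ≤_) (∣⁅x⁆∣≡1 x) (p⊆q⇒∣p∣≤∣q∣ p⊆⁅x⁆)

module _ {n : ℕ} (G : Graph n) where

  Adj-sym : ∀ {u v} → Adj G u v → Adj G v u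
  Adj-sym {u} {v} = subst T (Graph.sym G u v)

  ∈N⇔Adj : ∀ {u v} → u ∈ N G v ⇔ Adj G v u
  ∈N⇔Adj {u} {v} = mk⇔
    (Equivalence.from T-≡ ∘ trans (sym (lookup∘tabulate (adj G v) u)) ∘ []=⇒lookup)
    (lookup⇒[]= u (N G v) ∘ trans (lookup∘tabulate (adj G v) u) ∘ Equivalence.to T-≡)

  private
    variable
      P Q A B : Subset n
      u v : Fin n

  neighbour∉independent : Independent G Q → v ∈ Q → u ∈ N G v → u ∉ Q
  neighbour∉independent {v = v} {u} Q-ind v∈Q u∈Nv u∈Q =
    subst T (Q-ind v u v∈Q u∈Q) (Equivalence.to ∈N⇔Adj u∈Nv)

  boundary-deg≤1⇒N⊆ : OffensiveAlliance G P → InBoundary G P v → deg G P v ≤ 1 → N G v ⊆ P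
  boundary-deg≤1⇒N⊆ {P} {v} P-off v∈∂P deg≤1 {u} u∈Nv with u ∈? P
  ... | yes u∈P = u∈P
  ... | no  u∉P = ⊥-elim (n≮n 1 (≤-trans (s≤s 0<deg∁) (≤-trans (P-off v v∈∂P) deg≤1)))
    where
    0<deg∁ : 0 < deg G (∁ P) v
    0<deg∁ = x∈p⇒0<∣p∣ (x∈p∩q⁺ (u∈Nv , x∉p⇒x∈∁p u∉P))

  TokenSlide-sym : ∀ {x y} → TokenSlide G A B x y → TokenSlide G B A y x
  TokenSlide-sym (∣A∣≡∣B∣ , A─B≡⁅x⁆ , B─A≡⁅y⁆ , xy) = sym ∣A∣≡∣B∣ , B─A≡⁅y⁆ , A─B≡⁅x⁆ , Adj-sym xy

  slideTarget-N≡⁅slideSource⁆ : ∀ {x y} → Independent G B → OffensiveAlliance G A →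
                                TokenSlide G A B x y → N G y ≡ ⁅ x ⁆
  slideTarget-N≡⁅slideSource⁆ {B} {A} {x} {y} B-ind A-off (_ , A─B≡⁅x⁆ , B─A≡⁅y⁆ , xy) =
    ⊆-antisym Ny⊆⁅x⁆ ⁅x⁆⊆Ny
    where
    x∈A─B : x ∈ A ─ B
    x∈A─B = subst (x ∈_) (sym A─B≡⁅x⁆) (x∈⁅x⁆ x)
    y∈B─A : y ∈ B ─ A
    y∈B─A = subst (y ∈_) (sym B─A≡⁅y⁆) (x∈⁅x⁆ y)
    Ny∩A⊆⁅x⁆ : N G y ∩ A ⊆ ⁅ x ⁆
    Ny∩A⊆⁅x⁆ u∈Ny∩A with x∈p∩q⁻ (N G y) A u∈Ny∩A
    ... | u∈Ny , u∈A = subst (_ ∈_) A─B≡⁅x⁆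
      (x∈p∧x∉q⇒x∈p─q u∈A (neighbour∉independent B-ind (p─q⊆p B A y∈B─A) u∈Ny))
    Ny⊆A : N G y ⊆ A
    Ny⊆A = boundary-deg≤1⇒N⊆ A-off (x∈p─q⇒x∉q y∈B─A , x , p─q⊆p A B x∈A─B , xy)
                               (p⊆⁅x⁆⇒∣p∣≤1 Ny∩A⊆⁅x⁆)
    Ny⊆⁅x⁆ : N G y ⊆ ⁅ x ⁆
    Ny⊆⁅x⁆ u∈Ny = Ny∩A⊆⁅x⁆ (x∈p∩q⁺ (u∈Ny , Ny⊆A u∈Ny))
    ⁅x⁆⊆Ny : ⁅ x ⁆ ⊆ N G y
    ⁅x⁆⊆Ny u∈⁅x⁆ rewrite x∈⁅y⁆⇒x≡y x u∈⁅x⁆ = Equivalence.from ∈N⇔Adj (Adj-sym xy)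

lemma1 : {n : ℕ} (G : Graph n) (A B : Subset n) (x y : Fin n) →
         IndependentOffensiveAlliance G A → IndependentOffensiveAlliance G B →
         TokenSlide G A B x y →
         (N[_] G x ≡ ⁅ x ⁆ ∪ ⁅ y ⁆) × (N[_] G y ≡ ⁅ x ⁆ ∪ ⁅ y ⁆)
lemma1 G A B x y (A-ind , A-off) (B-ind , B-off) slide =
  trans (cong (_∪ ⁅ x ⁆) (slideTarget-N≡⁅slideSource⁆ G A-ind B-off (TokenSlide-sym G slide)))
        (∪-comm ⁅ y ⁆ ⁅ x ⁆) ,
  cong (_∪ ⁅ y ⁆) (slideTarget-N≡⁅slideSource⁆ G B-ind A-off slide)
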